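{- Let $K=\mathbb{Q}(\sqrt{D})$ where $D\in\mathbb{Z}_{\ge2}$ is squarefree, and let $n\in\mathbb{Z}_{\ge1}$. There exists $D_n>0$ such that if $D>D_n$, then $p_K(n)=p(n)$. Moreover, let $E_n=\lfloor n/2\rfloor^2$ and let $F_n=(n-1)^2$ if $n$ is even and $F_n=n^2$ if $n$ is odd. Then: - if $D\equiv2,3\pmod4$ and $D>E_n$, then $p_K(n)=p(n)$; - if $D\equiv1\pmod4$ and $D>F_n$, then $p_K(n)=p(n)$. The bounds $E_n$ and $F_n$ are optimal, in the sense that if $D\equiv2,3\pmod4$ and $D\le E_n$, then $p_K(n)>p(n)$, and if $D\equiv1\pmod4$ and $D\le F_n$, then $p_K(n)>p(n)$.
   Context: $\mathcal{O}_K$ is the ring of integers of $K$ and $\mathcal{O}_K^+$ is the set of totally positive elements of $\mathcal{O}_K$ (elements $\gamma$ with $\gamma>0$ and $\gamma'>0$, where $'$ denotes Galois conjugation). A partition of $\alpha\in\mathcal{O}_K^+$ is an expression $\alpha=\alpha_1+\dots+\alpha_k$ with $k\ge1$ and all $\alpha_i\in\mathcal{O}_K^+$, the order of the summands being irrelevant; $p_K(\alpha)$ is the number of partitions of $\alpha$. $p(n)$ denotes the classical number of integer partitions of $n$. -}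

module Defs where

open import Data.Nat as ℕ using (ℕ; zero; suc; _%_; _/_)
open import Data.Nat.Divisibility using (_∣_)
open import Data.Nat.Properties using ()
open import Data.Integer as ℤ using (ℤ; +_; -_)
open import Data.Product using (Σ; ∃; _×_; _,_; proj₁; proj₂)
open import Data.Sum using (_⊎_)
open import Data.List using (List; []; _∷_; foldr)
open import Data.Nat.ListAction using () renaming (sum to sumℕ)
open import Data.List.Relation.Unary.All using (All)
open import Data.List.Relation.Binary.Permutation.Propositional using (_↭_)
open import Data.Vec using (Vec; lookup)
open import Data.Fin using (Fin)
open import Data.Bool using (if_then_else_)
open import Relation.Nullary using (¬_)
open import Relation.Binary.PropositionalEquality using (_≡_)

SquareFree : ℕ → Set
SquareFree D = ∀ (k : ℕ) → (k ℕ.* k) ∣ D → k ≡ 1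

-- "x + y·√D > 0" for integers x, y and D ≥ 0, decided by exact integer
-- arithmetic (case split on signs, comparing squares).
PosSurd : ℕ → ℤ → ℤ → Set
PosSurd D x y =
    (ℤ.0ℤ ℤ.≤ y × ℤ.0ℤ ℤ.< x)
  ⊎ (ℤ.0ℤ ℤ.≤ y × x ℤ.≤ ℤ.0ℤ × x ℤ.* x ℤ.< (+ D) ℤ.* (y ℤ.* y))
  ⊎ (y ℤ.< ℤ.0ℤ × ℤ.0ℤ ℤ.< x × (+ D) ℤ.* (y ℤ.* y) ℤ.< x ℤ.* x)

-- Elements of O_K, K = ℚ(√D), are represented by their coordinates (a , b)
-- in the standard integral basis {1, ω}:
--   ω = √D          if D ≢ 1 (mod 4),
--   ω = (1 + √D)/2  if D ≡ 1 (mod 4).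
OK : Set
OK = ℤ × ℤ

-- halfSurd D (a , b) = (x , y) with a + b·ω = (x + y·√D)/2.
halfSurd : ℕ → OK → ℤ × ℤ
halfSurd D (a , b) =
  if (D % 4) ℕ.≡ᵇ 1
  then ((+ 2) ℤ.* a ℤ.+ b , b)
  else ((+ 2) ℤ.* a , (+ 2) ℤ.* b)

-- γ is totally positive: γ > 0 and its Galois conjugate γ' > 0.
TotPos : ℕ → OK → Set
TotPos D γ = PosSurd D (proj₁ (halfSurd D γ)) (proj₂ (halfSurd D γ))
           × PosSurd D (proj₁ (halfSurd D γ)) (ℤ.- proj₂ (halfSurd D γ))

_+K_ : OK → OK → OK
(a , b) +K (c , d) = (a ℤ.+ c , b ℤ.+ d)

sumK : List OK → OK
sumK = foldr _+K_ (ℤ.0ℤ , ℤ.0ℤ)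

ιK : ℕ → OK
ιK n = (+ n , ℤ.0ℤ)

-- a partition of α ∈ O_K⁺ (as a list; order irrelevant, handled by ↭ below)
IsPartitionK : ℕ → OK → List OK → Set
IsPartitionK D α l = ¬ (l ≡ []) × All (TotPos D) l × sumK l ≡ α

IsPartitionℕ : ℕ → List ℕ → Set
IsPartitionℕ n l = ¬ (l ≡ []) × All (λ k → 0 ℕ.< k) l × sumℕ l ≡ n

NumUpToPerm : {A : Set} → (List A → Set) → ℕ → Set
NumUpToPerm {A} P m =
  Σ (Vec (List A) m) λ v →
      (∀ i → P (lookup v i))
    × (∀ i j → lookup v i ↭ lookup v j → i ≡ j)
    × (∀ l → P l → ∃ λ i → l ↭ lookup v i)

pK≡ : ℕ → ℕ → ℕ → Set
pK≡ D n m = NumUpToPerm (IsPartitionK D (ιK n)) m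

p≡ : ℕ → ℕ → Set
p≡ n m = NumUpToPerm (IsPartitionℕ n) m

pKEqP : ℕ → ℕ → Set
pKEqP D n = Σ ℕ λ m → pK≡ D n m × p≡ n m

pKGtP : ℕ → ℕ → Set
pKGtP D n = Σ ℕ λ a → Σ ℕ λ b → pK≡ D n a × p≡ n b × b ℕ.< a

E : ℕ → ℕ
E n = (n / 2) ℕ.* (n / 2)

F : ℕ → ℕ
F n = if (n % 2) ℕ.≡ᵇ 0 then (n ℕ.∸ 1) ℕ.* (n ℕ.∸ 1) else n ℕ.* n

Admissible : ℕ → Set
Admissible D = 2 ℕ.≤ D × SquareFree D

-- A totally positive γ = (x + y√D)/2 of O_K has trace x > 0 and D y² < x². Traces are additive,
-- so the summands of a partition of n have traces adding up to 2n. Once D > E_n (resp. F_n),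
-- every totally positive γ ∉ ℤ has trace larger than n: in the hardest case, D ≡ 1 (mod 4) with n
-- even, a trace equal to n would make y = n - 2a even, and then 4D ≤ D y² < n² contradicts
-- (n-1)² < D. The coefficients of √D in a partition of n cancel, so a partition containing a
-- summand outside ℤ contains two of them, whose traces already exceed 2n. Hence all partitions of
-- n in O_K come from partitions in ℕ and p_K(n) = p(n). Conversely, D being squarefree is not a
-- square, so D ≤ E_n (resp. F_n) makes n = (k + √D) + (n - k - √D) with k = ⌊n/2⌋ (resp.
-- n = (p + ω) + (q + 1 - ω) with 2p + 1, 2q + 1 ∈ {n - 1, n + 1} or both equal to n) an extra
-- partition into totally positive elements, so p_K(n) > p(n). Finally D_n = n² bounds E_n and F_n.
module Submission where

open import Defs
open import Data.Nat as ℕ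
  using (ℕ; zero; suc; _+_; _*_; _∸_; _/_; _%_; _≤_; _<_; z≤n; s≤s; z<s)
import Data.Nat.Properties as ℕ
open import Data.Nat.DivMod
  using (m*n/n≡m; /-monoˡ-≤; m*n%n≡0; [m+kn]%n≡m%n; m%n<n; m≡m%n+[m/n]*n; m/n≤m; m/n*n≤m)
open import Data.Nat.Divisibility using (divides)
open import Data.Nat.Tactic.RingSolver using (solve-∀)
open import Data.Nat.ListAction using (sum)
open import Data.Integer as ℤ using (ℤ; +_; +[1+_]; -[1+_]; ∣_∣; 0ℤ)
import Data.Integer.Properties as ℤ
open import Data.Integer.Tactic.RingSolver using () renaming (solve-∀ to ℤ-solve-∀)
open import Data.Bool using (true; false)
open import Data.Product as Prod using (Σ; ∃; _×_; _,_; proj₁; proj₂)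
open import Data.Product.Properties using (≡-dec)
open import Data.Sum using (_⊎_; inj₁; inj₂)
open import Data.List
  using (List; []; _∷_; _++_; map; length; upTo; cartesianProductWith; cartesianProduct)
open import Data.List.Properties using (map-∘; map-cong; map-id; map-id-local; length-map)
open import Data.List.Membership.Propositional using (_∈_)
open import Data.List.Membership.Propositional.Properties
  using (∈-∃++; ∈-map⁺; ∈-map⁻; ∈-upTo⁺; ∈-++⁺ˡ; ∈-++⁺ʳ; ∈-cartesianProductWith⁺; ∈-cartesianProduct⁺)
open import Data.List.Relation.Unary.Any using (here; there)
open import Data.List.Relation.Unary.All as All using (All; []; _∷_)
open import Data.List.Relation.Unary.All.Properties using () renaming (map⁺ to All-map⁺)
open import Data.List.Relation.Binary.Permutation.Propositional
  using (_↭_; prep; ↭-refl; ↭-sym; ↭-trans)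
open import Data.List.Relation.Binary.Permutation.Propositional.Properties
  using (↭-empty-inv; ∈-resp-↭; drop-∷; shift; map⁺)
open import Data.Vec as Vec using (Vec; lookup)
open import Data.Vec.Properties using (lookup-map)
open import Data.Fin using (Fin) renaming (zero to fzero; suc to fsuc)
open import Data.Fin.Properties using (any?; injective⇒≤)
open import Relation.Nullary using (¬_; Dec; yes; no; contradiction; ¬?)
open import Relation.Nullary.Decidable using (_×-dec_; _⊎-dec_; decidable-stable)
open import Relation.Unary using (Decidable)
open import Relation.Binary.Definitions using (DecidableEquality)
open import Relation.Binary.PropositionalEquality
  using (_≡_; _≢_; refl; sym; trans; cong; cong₂; subst; subst₂; module ≡-Reasoning)

-- Counting lists up to permutation

module _ {A : Set} (_≟_ : DecidableEquality A) where
  open import Data.List.Membership.DecPropositional _≟_ using (_∈?_)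

  _↭?_ : (xs ys : List A) → Dec (xs ↭ ys)
  [] ↭? [] = yes ↭-refl
  [] ↭? (y ∷ ys) = no λ p → contradiction (↭-empty-inv (↭-sym p)) λ ()
  (x ∷ xs) ↭? ys with x ∈? ys
  ... | no x∉ys = no λ p → x∉ys (∈-resp-↭ p (here refl))
  ... | yes x∈ys with ∈-∃++ x∈ys
  ... | ws , zs , refl with xs ↭? (ws ++ zs)
  ... | yes p = yes (↭-trans (prep x p) (↭-sym (shift x ws zs)))
  ... | no ¬p = no λ q → ¬p (drop-∷ (↭-trans q (shift x ws zs)))

  numUpToPerm-∈ : {P : List A → Set} → Decidable P → (L : List (List A)) →
                  ∃ λ m → NumUpToPerm (λ l → l ∈ L × P l) m
  numUpToPerm-∈ P? [] = 0 , Vec.[] , (λ ()) , (λ ()) , λ _ ()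
  numUpToPerm-∈ {P} P? (c ∷ L) with numUpToPerm-∈ P? L
  ... | m , v , inP , distinct , cover with P? c ×-dec ¬? (any? λ i → c ↭? lookup v i)
  ... | yes (Pc , c-new) = suc m , c Vec.∷ v , inP′ , distinct′ , cover′
    where
      inP′ : ∀ i → lookup (c Vec.∷ v) i ∈ c ∷ L × P (lookup (c Vec.∷ v) i)
      inP′ fzero = here refl , Pc
      inP′ (fsuc i) = Prod.map₁ there (inP i)
      distinct′ : ∀ i j → lookup (c Vec.∷ v) i ↭ lookup (c Vec.∷ v) j → i ≡ j
      distinct′ fzero fzero _ = refl
      distinct′ fzero (fsuc j) p = contradiction (j , p) c-new
      distinct′ (fsuc i) fzero p = contradiction (i , ↭-sym p) c-new
      distinct′ (fsuc i) (fsuc j) p = cong fsuc (distinct i j p)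
      cover′ : ∀ l → l ∈ c ∷ L × P l → ∃ λ i → l ↭ lookup (c Vec.∷ v) i
      cover′ l (here refl , _) = fzero , ↭-refl
      cover′ l (there l∈L , Pl) = Prod.map fsuc (λ l↭vi → l↭vi) (cover l (l∈L , Pl))
  ... | no ¬[Pc×c-new] = m , v , (λ i → Prod.map₁ there (inP i)) , distinct , cover′
    where
      cover′ : ∀ l → l ∈ c ∷ L × P l → ∃ λ i → l ↭ lookup v i
      cover′ l (here refl , Pl) =
        decidable-stable (any? λ i → c ↭? lookup v i) λ c-new → ¬[Pc×c-new] (Pl , c-new)
      cover′ l (there l∈L , Pl) = cover l (l∈L , Pl)

  numUpToPerm-finite : {P : List A → Set} → Decidable P → (L : List (List A)) →
                       (∀ l → P l → l ∈ L) → ∃ λ m → NumUpToPerm P m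
  numUpToPerm-finite P? L P⊆L with numUpToPerm-∈ P? L
  ... | m , v , inP , distinct , cover =
    m , v , (λ i → proj₂ (inP i)) , distinct , λ l Pl → cover l (P⊆L l Pl , Pl)

module _ {A : Set} {P : List A → Set} where

  ≤-numUpToPerm : {a k : ℕ} → NumUpToPerm P a → (u : Fin k → List A) → (∀ j → P (u j)) →
                  (∀ i j → u i ↭ u j → i ≡ j) → k ≤ a
  ≤-numUpToPerm (w , _ , _ , cover) u Pu u-distinct = injective⇒≤ rep-injective
    where
      rep : ∀ j → ∃ λ i → u j ↭ lookup w i
      rep j = cover (u j) (Pu j)
      rep-injective : ∀ {i j} → proj₁ (rep i) ≡ proj₁ (rep j) → i ≡ j
      rep-injective {i} {j} eq with rep i | rep j | eq
      ... | _ , ui↭wr | _ , uj↭wr | refl = u-distinct i j (↭-trans ui↭wr (↭-sym uj↭wr))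

module _ {A B : Set} (f : A → B) (g : B → A) (g∘f≗id : ∀ x → g (f x) ≡ x) where

  map-leftInverse : (xs : List A) → map g (map f xs) ≡ xs
  map-leftInverse xs = trans (sym (map-∘ xs)) (trans (map-cong g∘f≗id xs) (map-id xs))

  map-↭-reflects : {xs ys : List A} → map f xs ↭ map f ys → xs ↭ ys
  map-↭-reflects {xs} {ys} p = subst₂ _↭_ (map-leftInverse xs) (map-leftInverse ys) (map⁺ g p)

  module _ {P : List A → Set} {Q : List B → Set} (P⇒Q : ∀ l → P l → Q (map f l)) where

    numUpToPerm-map : {m : ℕ} → (∀ l → Q l → ∃ λ l₀ → P l₀ × l ≡ map f l₀) →
                      NumUpToPerm P m → NumUpToPerm Q m
    numUpToPerm-map Q⇒P (v , inP , distinct , cover) = Vec.map (map f) v , inQ , distinct′ , cover′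
      where
        lookup-map-f : ∀ i → lookup (Vec.map (map f) v) i ≡ map f (lookup v i)
        lookup-map-f i = lookup-map i (map f) v
        inQ : ∀ i → Q (lookup (Vec.map (map f) v) i)
        inQ i = subst Q (sym (lookup-map-f i)) (P⇒Q _ (inP i))
        distinct′ : ∀ i j → lookup (Vec.map (map f) v) i ↭ lookup (Vec.map (map f) v) j → i ≡ j
        distinct′ i j p =
          distinct i j (map-↭-reflects (subst₂ _↭_ (lookup-map-f i) (lookup-map-f j) p))
        cover′ : ∀ l → Q l → ∃ λ i → l ↭ lookup (Vec.map (map f) v) i
        cover′ l Ql with Q⇒P l Ql
        ... | l₀ , Pl₀ , refl with cover l₀ Pl₀
        ... | i , l₀↭vi = i , subst (map f l₀ ↭_) (sym (lookup-map-f i)) (map⁺ f l₀↭vi)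

    <-numUpToPerm-map : {a b : ℕ} → NumUpToPerm P b → NumUpToPerm Q a →
                        (l* : List B) → Q l* → (x : B) → x ∈ l* → (∀ y → x ≢ f y) → b < a
    <-numUpToPerm-map {b = b} (v , inP , distinct , _) countQ l* Ql* x x∈l* x∉f =
      ≤-numUpToPerm countQ u Qu u-distinct
      where
        u : Fin (suc b) → List B
        u fzero = l*
        u (fsuc i) = map f (lookup v i)
        Qu : ∀ j → Q (u j)
        Qu fzero = Ql*
        Qu (fsuc i) = P⇒Q _ (inP i)
        l*≁map : ∀ l → ¬ (l* ↭ map f l)
        l*≁map l p with ∈-map⁻ f (∈-resp-↭ p x∈l*)
        ... | y , _ , x≡fy = x∉f y x≡fy
        u-distinct : ∀ i j → u i ↭ u j → i ≡ j
        u-distinct fzero fzero _ = refl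
        u-distinct fzero (fsuc j) p = contradiction p (l*≁map _)
        u-distinct (fsuc i) fzero p = contradiction (↭-sym p) (l*≁map _)
        u-distinct (fsuc i) (fsuc j) p = cong fsuc (distinct i j (map-↭-reflects p))

listsOfLength≤ : {A : Set} → ℕ → List A → List (List A)
listsOfLength≤ zero B = [] ∷ []
listsOfLength≤ (suc N) B = [] ∷ cartesianProductWith _∷_ B (listsOfLength≤ N B)

∈-listsOfLength≤ : {A : Set} {N : ℕ} {B l : List A} →
                   length l ≤ N → All (_∈ B) l → l ∈ listsOfLength≤ N B
∈-listsOfLength≤ {N = zero} {l = []} _ _ = here refl
∈-listsOfLength≤ {N = suc N} {l = []} _ _ = here refl
∈-listsOfLength≤ {N = suc N} {l = x ∷ l} (s≤s len≤N) (x∈B ∷ l⊆B) =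
  there (∈-cartesianProductWith⁺ _∷_ x∈B (∈-listsOfLength≤ len≤N l⊆B))

nonEmpty? : {A : Set} (l : List A) → Dec (¬ (l ≡ []))
nonEmpty? [] = no λ l≢[] → l≢[] refl
nonEmpty? (_ ∷ _) = yes λ ()

length≤sum : {ns : List ℕ} → All (0 <_) ns → length ns ≤ sum ns
length≤sum [] = z≤n
length≤sum (0<n ∷ 0<ns) = ℕ.+-mono-≤ 0<n (length≤sum 0<ns)

∈⇒≤sum : {n : ℕ} {ns : List ℕ} → n ∈ ns → n ≤ sum ns
∈⇒≤sum {ns = m ∷ ns} (here refl) = ℕ.m≤m+n m (sum ns)
∈⇒≤sum {ns = m ∷ ns} (there n∈ns) = ℕ.≤-trans (∈⇒≤sum n∈ns) (ℕ.m≤n+m (sum ns) m)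

isPartitionℕ? : (n : ℕ) → Decidable (IsPartitionℕ n)
isPartitionℕ? n l = nonEmpty? l ×-dec (All.all? (0 ℕ.<?_) l ×-dec (sum l ℕ.≟ n))

p-exists : (n : ℕ) → ∃ λ m → p≡ n m
p-exists n =
  numUpToPerm-finite ℕ._≟_ (isPartitionℕ? n) (listsOfLength≤ n (upTo (suc n))) partition∈
  where
    partition∈ : ∀ l → IsPartitionℕ n l → l ∈ listsOfLength≤ n (upTo (suc n))
    partition∈ l (_ , 0<l , refl) =
      ∈-listsOfLength≤ (length≤sum 0<l) (All.tabulate λ k∈l → ∈-upTo⁺ (s≤s (∈⇒≤sum k∈l)))

m*m<n*n⇒m<n : ∀ {m n} → m * m < n * n → m < n
m*m<n*n⇒m<n m²<n² = ℕ.≰⇒> λ n≤m → ℕ.<⇒≱ m²<n² (ℕ.*-mono-≤ n≤m n≤m)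

normBound⇒< : ∀ {D m x y} → m * m < D → 0 < y → D * (y * y) < x * x → m < x
normBound⇒< {D} {m} {x} {y} m²<D 0<y Dy²<x² = m*m<n*n⇒m<n (begin-strict
  m * m        <⟨ m²<D ⟩
  D            ≤⟨ ℕ.m≤m*n D (y * y) ⟩
  D * (y * y)  <⟨ Dy²<x² ⟩
  x * x        ∎)
  where
    open ℕ.≤-Reasoning
    instance
      y²≢0 : ℕ.NonZero (y * y)
      y²≢0 = ℕ.>-nonZero (ℕ.*-mono-< 0<y 0<y)

D*[2u]²≡4*D*u² : ∀ D u → D * ((2 * u) * (2 * u)) ≡ 4 * (D * (u * u))
D*[2u]²≡4*D*u² = solve-∀

[2t]²≡4*t² : ∀ t → (2 * t) * (2 * t) ≡ 4 * (t * t)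
[2t]²≡4*t² = solve-∀

halve-normBound : ∀ D u t → D * ((2 * u) * (2 * u)) < (2 * t) * (2 * t) → D * (u * u) < t * t
halve-normBound D u t bound =
  ℕ.*-cancelˡ-< 4 (D * (u * u)) (t * t) (subst₂ _<_ (D*[2u]²≡4*D*u² D u) ([2t]²≡4*t² t) bound)

double-normBound : ∀ D u t → D * (u * u) < t * t → D * ((2 * u) * (2 * u)) < (2 * t) * (2 * t)
double-normBound D u t bound =
  subst₂ _<_ (sym (D*[2u]²≡4*D*u² D u)) (sym ([2t]²≡4*t² t)) (ℕ.*-monoʳ-< 4 bound)

<square⇒0< : ∀ {D} x → D < x * x → 0 < x
<square⇒0< zero D<0 = contradiction D<0 ℕ.n≮0
<square⇒0< (suc _) _ = z<s

/2<⇒<2* : ∀ {n k} → n / 2 < k → n < 2 * k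
/2<⇒<2* {n} {k} n/2<k = ℕ.≰⇒> λ 2k≤n → ℕ.<⇒≱ n/2<k
  (subst (_≤ n / 2) (m*n/n≡m k 2) (/-monoˡ-≤ 2 (subst (_≤ n) (ℕ.*-comm 2 k) 2k≤n)))

data Parity : ℕ → Set where
  even : ∀ t → Parity (t * 2)
  odd  : ∀ t → Parity (1 + t * 2)

parity : ∀ n → Parity n
parity zero = even 0
parity (suc zero) = odd 0
parity (suc (suc n)) with parity n
... | even t = even (suc t)
... | odd t = odd (suc t)

F-even : ∀ t → F (t * 2) ≡ (t * 2 ∸ 1) * (t * 2 ∸ 1)
F-even t with t * 2 % 2 | m*n%n≡0 t 2
... | _ | refl = refl

F-odd : ∀ t → F (1 + t * 2) ≡ (1 + t * 2) * (1 + t * 2)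
F-odd t with (1 + t * 2) % 2 | [m+kn]%n≡m%n 1 t 2
... | _ | refl = refl

E≤square : ∀ n → E n ≤ n * n
E≤square n = ℕ.*-mono-≤ (m/n≤m n 2) (m/n≤m n 2)

F≤square : ∀ n → F n ≤ n * n
F≤square n with parity n
... | even t = subst (_≤ t * 2 * (t * 2)) (sym (F-even t))
                 (ℕ.*-mono-≤ (ℕ.m∸n≤m (t * 2) 1) (ℕ.m∸n≤m (t * 2) 1))
... | odd t = ℕ.≤-reflexive (F-odd t)

Admissible⇒0<D : ∀ {D} → Admissible D → 0 < D
Admissible⇒0<D (2≤D , _) = ℕ.≤-trans (s≤s z≤n) 2≤D

Admissible⇒≢square : ∀ {D} → Admissible D → ∀ k → D ≢ k * k
Admissible⇒≢square (2≤D , squareFree) k D≡k²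
  with squareFree k (divides 1 (trans D≡k² (sym (ℕ.*-identityˡ _))))
... | refl = contradiction (subst (2 ≤_) D≡k² 2≤D) λ { (s≤s ()) }

Admissible⇒<square : ∀ {D} → Admissible D → ∀ k → D ≤ k * k → D < k * k
Admissible⇒<square D-adm k D≤k² with ℕ.m≤n⇒m<n∨m≡n D≤k²
... | inj₁ D<k² = D<k²
... | inj₂ D≡k² = contradiction D≡k² (Admissible⇒≢square D-adm k)

Admissible⇒mod4 : ∀ {D} → Admissible D → D % 4 ≡ 1 ⊎ (D % 4 ≡ 2 ⊎ D % 4 ≡ 3)
Admissible⇒mod4 {D} (_ , squareFree) with D % 4 | m%n<n D 4 | m≡m%n+[m/n]*n D 4
... | 0 | _ | D≡[D/4]*4 = contradiction (squareFree 2 (divides (D / 4) D≡[D/4]*4)) λ ()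
... | 1 | _ | _ = inj₁ refl
... | 2 | _ | _ = inj₂ (inj₁ refl)
... | 3 | _ | _ = inj₂ (inj₂ refl)
... | suc (suc (suc (suc _))) | s≤s (s≤s (s≤s (s≤s ()))) | _

i*i≡+∣i∣*∣i∣ : ∀ i → i ℤ.* i ≡ + (∣ i ∣ * ∣ i ∣)
i*i≡+∣i∣*∣i∣ (+ k) = sym (ℤ.pos-* k k)
i*i≡+∣i∣*∣i∣ -[1+ k ] = refl

i≢0⇒0<∣i∣ : ∀ {i} → i ≢ 0ℤ → 0 < ∣ i ∣
i≢0⇒0<∣i∣ i≢0 = ℕ.n≢0⇒n>0 λ ∣i∣≡0 → i≢0 (ℤ.∣i∣≡0⇒i≡0 ∣i∣≡0)

∣i∣≤∣2i∣ : ∀ i → ∣ i ∣ ≤ ∣ + 2 ℤ.* i ∣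
∣i∣≤∣2i∣ i = subst (∣ i ∣ ≤_) (sym (ℤ.abs-* (+ 2) i)) (ℕ.m≤n*m ∣ i ∣ 2)

∣b∣≡2∣t-a∣ : ∀ a b t → + 2 ℤ.* a ℤ.+ b ≡ + (t * 2) → ∣ b ∣ ≡ 2 * ∣ + t ℤ.- a ∣
∣b∣≡2∣t-a∣ a b t 2a+b≡2t = trans (cong ∣_∣ b≡2[t-a]) (ℤ.abs-* (+ 2) (+ t ℤ.- a))
  where
    open ≡-Reasoning
    cancel : ∀ a b → b ≡ (+ 2 ℤ.* a ℤ.+ b) ℤ.- + 2 ℤ.* a
    cancel = ℤ-solve-∀
    factor : ∀ a t → + 2 ℤ.* t ℤ.- + 2 ℤ.* a ≡ + 2 ℤ.* (t ℤ.- a)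
    factor = ℤ-solve-∀
    [t*2]≡2*t : + (t * 2) ≡ + 2 ℤ.* + t
    [t*2]≡2*t = trans (cong +_ (ℕ.*-comm t 2)) (ℤ.pos-* 2 t)
    b≡2[t-a] : b ≡ + 2 ℤ.* (+ t ℤ.- a)
    b≡2[t-a] = begin
      b                                ≡⟨ cancel a b ⟩
      (+ 2 ℤ.* a ℤ.+ b) ℤ.- + 2 ℤ.* a  ≡⟨ cong (ℤ._- (+ 2 ℤ.* a)) 2a+b≡2t ⟩
      + (t * 2) ℤ.- + 2 ℤ.* a          ≡⟨ cong (ℤ._- (+ 2 ℤ.* a)) [t*2]≡2*t ⟩
      + 2 ℤ.* + t ℤ.- + 2 ℤ.* a        ≡⟨ factor a (+ t) ⟩
      + 2 ℤ.* (+ t ℤ.- a)              ∎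

integersUpTo : ℕ → List ℤ
integersUpTo R = map +_ (upTo (suc R)) ++ map -[1+_] (upTo R)

∈-integersUpTo : ∀ {R i} → ∣ i ∣ ≤ R → i ∈ integersUpTo R
∈-integersUpTo {R} {+ k} k≤R = ∈-++⁺ˡ (∈-map⁺ +_ (∈-upTo⁺ (s≤s k≤R)))
∈-integersUpTo {R} { -[1+ k ]} k<R =
  ∈-++⁺ʳ (map +_ (upTo (suc R))) (∈-map⁺ -[1+_] (∈-upTo⁺ k<R))

-- γ = (trace D γ + surdCoeff D γ · √D) / 2, so trace D γ is γ + γ'.
trace : ℕ → OK → ℤ
trace D γ = proj₁ (halfSurd D γ)

surdCoeff : ℕ → OK → ℤ
surdCoeff D γ = proj₂ (halfSurd D γ)

traceℕ : ℕ → OK → ℕ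
traceℕ D γ = ∣ trace D γ ∣

Rational : OK → Set
Rational γ = proj₂ γ ≡ 0ℤ

rationalPart : OK → ℕ
rationalPart γ = ∣ proj₁ γ ∣

sumK-map-ιK : ∀ ns → sumK (map ιK ns) ≡ ιK (sum ns)
sumK-map-ιK [] = refl
sumK-map-ιK (k ∷ ns) = cong (ιK k +K_) (sumK-map-ιK ns)

_≟K_ : DecidableEquality OK
_≟K_ = ≡-dec ℤ._≟_ ℤ._≟_

posSurd? : ∀ D x y → Dec (PosSurd D x y)
posSurd? D x y =
      (0ℤ ℤ.≤? y ×-dec 0ℤ ℤ.<? x)
  ⊎-dec (0ℤ ℤ.≤? y ×-dec (x ℤ.≤? 0ℤ ×-dec x ℤ.* x ℤ.<? + D ℤ.* (y ℤ.* y)))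
  ⊎-dec (y ℤ.<? 0ℤ ×-dec (0ℤ ℤ.<? x ×-dec + D ℤ.* (y ℤ.* y) ℤ.<? x ℤ.* x))

isPartitionK? : ∀ D α → Decidable (IsPartitionK D α)
isPartitionK? D α l = nonEmpty? l ×-dec (All.all? totPos? l ×-dec (sumK l ≟K α))
  where
    totPos? : Decidable (TotPos D)
    totPos? γ = posSurd? D _ _ ×-dec posSurd? D _ _

module _ {P : OK → Set} (W : OK → ℕ) {n : ℕ}
         (irrational-large : ∀ {γ} → P γ → ¬ Rational γ → n < W γ) where

  irrational-sum-large : ∀ {l} → All P l → ¬ Rational (sumK l) → n < sum (map W l)
  irrational-sum-large [] Σ≢0 = contradiction refl Σ≢0
  irrational-sum-large {(a , b) ∷ l} (Pγ ∷ Pl) Σ≢0 with b ℤ.≟ 0ℤ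
  ... | no b≢0 = ℕ.≤-trans (irrational-large Pγ b≢0) (ℕ.m≤m+n _ _)
  ... | yes refl =
    ℕ.≤-trans (irrational-sum-large Pl λ Σl≡0 → Σ≢0 (trans (ℤ.+-identityˡ _) Σl≡0)) (ℕ.m≤n+m _ _)

  -- An irrational summand cannot occur alone, since the ω-coordinates add up to 0, and two of
  -- them already weigh more than n + n.
  all-rational : ∀ {l} → All P l → Rational (sumK l) → sum (map W l) ≤ n + n → All Rational l
  all-rational [] _ _ = []
  all-rational {(a , b) ∷ l} (Pγ ∷ Pl) Σ≡0 Σ≤2n with b ℤ.≟ 0ℤ
  ... | yes refl =
    refl ∷ all-rational Pl (trans (sym (ℤ.+-identityˡ _)) Σ≡0) (ℕ.≤-trans (ℕ.m≤n+m _ _) Σ≤2n)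
  ... | no b≢0 = contradiction Σ≤2n
    (ℕ.<⇒≱ (ℕ.+-mono-< (irrational-large Pγ b≢0) (irrational-sum-large Pl Σl≢0)))
    where
      Σl≢0 : ¬ Rational (sumK l)
      Σl≢0 Σl≡0 = b≢0 (trans (sym (ℤ.+-identityʳ b)) (trans (cong (ℤ._+_ b) (sym Σl≡0)) Σ≡0))

module _ {D : ℕ} where

  halfSurd-1mod4 : D % 4 ≡ 1 → ∀ a b → halfSurd D (a , b) ≡ (+ 2 ℤ.* a ℤ.+ b , b)
  halfSurd-1mod4 D≡1 a b rewrite D≡1 = refl

  halfSurd-2,3mod4 : D % 4 ≡ 2 ⊎ D % 4 ≡ 3 → ∀ a b → halfSurd D (a , b) ≡ (+ 2 ℤ.* a , + 2 ℤ.* b)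
  halfSurd-2,3mod4 (inj₁ D≡2) a b rewrite D≡2 = refl
  halfSurd-2,3mod4 (inj₂ D≡3) a b rewrite D≡3 = refl

  halfSurd-ιK : ∀ k → halfSurd D (ιK k) ≡ (+ (2 * k) , 0ℤ)
  halfSurd-ιK k with D % 4 ℕ.≡ᵇ 1
  ... | true = cong (_, 0ℤ) (trans (ℤ.+-identityʳ (+ 2 ℤ.* + k)) (sym (ℤ.pos-* 2 k)))
  ... | false = cong (_, 0ℤ) (sym (ℤ.pos-* 2 k))

  trace-rational : ∀ a → trace D (a , 0ℤ) ≡ + 2 ℤ.* a
  trace-rational a with D % 4 ℕ.≡ᵇ 1
  ... | true = ℤ.+-identityʳ (+ 2 ℤ.* a)
  ... | false = refl

  trace-+K : ∀ γ δ → trace D (γ +K δ) ≡ trace D γ ℤ.+ trace D δ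
  trace-+K (a , b) (c , d) with D % 4 ℕ.≡ᵇ 1
  ... | true = interchange a b c d
    where
      interchange : ∀ a b c d →
                    + 2 ℤ.* (a ℤ.+ c) ℤ.+ (b ℤ.+ d) ≡ (+ 2 ℤ.* a ℤ.+ b) ℤ.+ (+ 2 ℤ.* c ℤ.+ d)
      interchange = ℤ-solve-∀
  ... | false = ℤ.*-distribˡ-+ (+ 2) a c

  coords≤trace+surdCoeff : ∀ a b → let R = traceℕ D (a , b) + ∣ surdCoeff D (a , b) ∣ in
                           ∣ a ∣ ≤ R × ∣ b ∣ ≤ R
  coords≤trace+surdCoeff a b with D % 4 ℕ.≡ᵇ 1
  ... | true = ∣a∣≤ , ℕ.m≤n+m ∣ b ∣ _
    where
      2a≡[2a+b]-b : ∀ a b → + 2 ℤ.* a ≡ (+ 2 ℤ.* a ℤ.+ b) ℤ.- b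
      2a≡[2a+b]-b = ℤ-solve-∀
      ∣a∣≤ : ∣ a ∣ ≤ ∣ + 2 ℤ.* a ℤ.+ b ∣ + ∣ b ∣
      ∣a∣≤ = ℕ.≤-trans (∣i∣≤∣2i∣ a) (subst (_≤ ∣ + 2 ℤ.* a ℤ.+ b ∣ + ∣ b ∣)
               (cong ∣_∣ (sym (2a≡[2a+b]-b a b))) (ℤ.∣i-j∣≤∣i∣+∣j∣ (+ 2 ℤ.* a ℤ.+ b) b))
  ... | false = ℕ.≤-trans (∣i∣≤∣2i∣ a) (ℕ.m≤m+n _ _) , ℕ.≤-trans (∣i∣≤∣2i∣ b) (ℕ.m≤n+m _ _)

  irrational⇒0<∣surdCoeff∣ : ∀ {γ} → ¬ Rational γ → 0 < ∣ surdCoeff D γ ∣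
  irrational⇒0<∣surdCoeff∣ {a , b} b≢0 with D % 4 ℕ.≡ᵇ 1
  ... | true = i≢0⇒0<∣i∣ b≢0
  ... | false = subst (0 <_) (sym (ℤ.abs-* (+ 2) b)) (ℕ.*-monoʳ-< 2 (i≢0⇒0<∣i∣ b≢0))

  +D*[i*i]≡+D*∣i∣*∣i∣ : ∀ i → + D ℤ.* (i ℤ.* i) ≡ + (D * (∣ i ∣ * ∣ i ∣))
  +D*[i*i]≡+D*∣i∣*∣i∣ i = trans (cong (+ D ℤ.*_) (i*i≡+∣i∣*∣i∣ i)) (sym (ℤ.pos-* D _))

  normBound-ℤ⇒ℕ : ∀ x y → + D ℤ.* (y ℤ.* y) ℤ.< x ℤ.* x → D * (∣ y ∣ * ∣ y ∣) < ∣ x ∣ * ∣ x ∣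
  normBound-ℤ⇒ℕ x y bound =
    ℤ.drop‿+<+ (subst₂ ℤ._<_ (+D*[i*i]≡+D*∣i∣*∣i∣ y) (i*i≡+∣i∣*∣i∣ x) bound)

  normBound-ℕ⇒ℤ : ∀ x y → D * (∣ y ∣ * ∣ y ∣) < x * x → + D ℤ.* (y ℤ.* y) ℤ.< + x ℤ.* + x
  normBound-ℕ⇒ℤ x y bound =
    subst₂ ℤ._<_ (sym (+D*[i*i]≡+D*∣i∣*∣i∣ y)) (sym (i*i≡+∣i∣*∣i∣ (+ x))) (ℤ.+<+ bound)

  PosSurd²⇒0<x : ∀ x y → PosSurd D x y → PosSurd D x (ℤ.- y) → 0ℤ ℤ.< x
  PosSurd²⇒0<x _ _ (inj₁ (_ , 0<x)) _ = 0<x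
  PosSurd²⇒0<x _ _ (inj₂ (inj₂ (_ , 0<x , _))) _ = 0<x
  PosSurd²⇒0<x _ _ (inj₂ (inj₁ _)) (inj₁ (_ , 0<x)) = 0<x
  PosSurd²⇒0<x _ _ (inj₂ (inj₁ _)) (inj₂ (inj₂ (_ , 0<x , _))) = 0<x
  PosSurd²⇒0<x x (+ zero) (inj₂ (inj₁ (_ , _ , x²<0))) (inj₂ (inj₁ _)) =
    contradiction (subst (∣ x ∣ * ∣ x ∣ <_) (ℕ.*-zeroʳ D) x²<D*0²) ℕ.n≮0
    where
      x²<D*0² : ∣ x ∣ * ∣ x ∣ < D * 0
      x²<D*0² = ℤ.drop‿+<+ (subst₂ ℤ._<_ (i*i≡+∣i∣*∣i∣ x) (+D*[i*i]≡+D*∣i∣*∣i∣ 0ℤ) x²<0)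
  PosSurd²⇒0<x _ +[1+ _ ] (inj₂ (inj₁ _)) (inj₂ (inj₁ (() , _)))
  PosSurd²⇒0<x _ -[1+ _ ] (inj₂ (inj₁ (() , _))) (inj₂ (inj₁ _))

  PosSurd²⇒normBound : ∀ x y → PosSurd D x y → PosSurd D x (ℤ.- y) →
                       D * (∣ y ∣ * ∣ y ∣) < ∣ x ∣ * ∣ x ∣
  PosSurd²⇒normBound x (+ zero) p q with PosSurd²⇒0<x x 0ℤ p q
  ... | ℤ.+<+ {n = suc j} _ = subst (_< suc j * suc j) (sym (ℕ.*-zeroʳ D)) z<s
  PosSurd²⇒normBound x +[1+ k ] _ (inj₂ (inj₂ (_ , _ , bound))) = normBound-ℤ⇒ℕ x -[1+ k ] bound
  PosSurd²⇒normBound x -[1+ k ] (inj₂ (inj₂ (_ , _ , bound))) _ = normBound-ℤ⇒ℕ x -[1+ k ] bound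
  PosSurd²⇒normBound _ +[1+ _ ] _ (inj₁ (() , _))
  PosSurd²⇒normBound _ +[1+ _ ] _ (inj₂ (inj₁ (() , _)))
  PosSurd²⇒normBound _ -[1+ _ ] (inj₁ (() , _)) _
  PosSurd²⇒normBound _ -[1+ _ ] (inj₂ (inj₁ (() , _))) _

  normBound⇒PosSurd² : ∀ x y → 0 < x → D * (∣ y ∣ * ∣ y ∣) < x * x →
                       PosSurd D (+ x) y × PosSurd D (+ x) (ℤ.- y)
  normBound⇒PosSurd² x (+ zero) 0<x _ =
    inj₁ (ℤ.+≤+ z≤n , ℤ.+<+ 0<x) , inj₁ (ℤ.+≤+ z≤n , ℤ.+<+ 0<x)
  normBound⇒PosSurd² x +[1+ k ] 0<x bound =
    inj₁ (ℤ.+≤+ z≤n , ℤ.+<+ 0<x) , inj₂ (inj₂ (ℤ.-<+ , ℤ.+<+ 0<x , normBound-ℕ⇒ℤ x -[1+ k ] bound))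
  normBound⇒PosSurd² x -[1+ k ] 0<x bound =
    inj₂ (inj₂ (ℤ.-<+ , ℤ.+<+ 0<x , normBound-ℕ⇒ℤ x -[1+ k ] bound)) , inj₁ (ℤ.+≤+ z≤n , ℤ.+<+ 0<x)

  module _ {γ : OK} (γ⁺ : TotPos D γ) where

    TotPos⇒0<trace : 0ℤ ℤ.< trace D γ
    TotPos⇒0<trace = PosSurd²⇒0<x _ _ (proj₁ γ⁺) (proj₂ γ⁺)

    TotPos⇒trace≡+traceℕ : trace D γ ≡ + traceℕ D γ
    TotPos⇒trace≡+traceℕ = sym (ℤ.0≤i⇒+∣i∣≡i (ℤ.<⇒≤ TotPos⇒0<trace))

    TotPos⇒0<traceℕ : 0 < traceℕ D γ
    TotPos⇒0<traceℕ = ℤ.drop‿+<+ (subst (0ℤ ℤ.<_) TotPos⇒trace≡+traceℕ TotPos⇒0<trace)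

    TotPos⇒normBound : D * (∣ surdCoeff D γ ∣ * ∣ surdCoeff D γ ∣) < traceℕ D γ * traceℕ D γ
    TotPos⇒normBound = PosSurd²⇒normBound _ _ (proj₁ γ⁺) (proj₂ γ⁺)

  TotPos⇒surdCoeff≤trace : 0 < D → ∀ {γ} → TotPos D γ → ∣ surdCoeff D γ ∣ ≤ traceℕ D γ
  TotPos⇒surdCoeff≤trace 0<D γ⁺ =
    ℕ.<⇒≤ (m*m<n*n⇒m<n (ℕ.≤-<-trans (ℕ.m≤n*m _ D) (TotPos⇒normBound γ⁺)))
    where
      instance
        D≢0 : ℕ.NonZero D
        D≢0 = ℕ.>-nonZero 0<D

  TotPos-intro : ∀ {γ} x y → halfSurd D γ ≡ (+ x , y) → 0 < x → D * (∣ y ∣ * ∣ y ∣) < x * x →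
                 TotPos D γ
  TotPos-intro x y eq 0<x bound rewrite eq = normBound⇒PosSurd² x y 0<x bound

  TotPos-ιK : ∀ {k} → 0 < k → TotPos D (ιK k)
  TotPos-ιK {k} 0<k = TotPos-intro {ιK k} (2 * k) 0ℤ (halfSurd-ιK k) 0<2k
                        (subst (_< 2 * k * (2 * k)) (sym (ℕ.*-zeroʳ D)) (ℕ.*-mono-< 0<2k 0<2k))
    where
      0<2k : 0 < 2 * k
      0<2k = ℕ.*-monoʳ-< 2 0<k

  TotPos-rational⇒ιK : ∀ {γ} → TotPos D γ → Rational γ →
                       ιK (rationalPart γ) ≡ γ × 0 < rationalPart γ
  TotPos-rational⇒ιK {a , _} γ⁺ refl with a | subst (0ℤ ℤ.<_) (trace-rational a) (TotPos⇒0<trace γ⁺)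
  ... | +[1+ _ ] | _ = refl , z<s
  ... | + zero | ℤ.+<+ ()

  TotPos-2,3mod4 : D % 4 ≡ 2 ⊎ D % 4 ≡ 3 → ∀ k b → ∣ b ∣ ≡ 1 → D < k * k → TotPos D (+ k , b)
  TotPos-2,3mod4 D≢1 k b ∣b∣≡1 D<k² =
    TotPos-intro {+ k , b} (2 * k) (+ 2 ℤ.* b) halfSurd≡ (ℕ.*-monoʳ-< 2 (<square⇒0< k D<k²)) bound
    where
      halfSurd≡ : halfSurd D (+ k , b) ≡ (+ (2 * k) , + 2 ℤ.* b)
      halfSurd≡ = trans (halfSurd-2,3mod4 D≢1 (+ k) b) (cong (_, + 2 ℤ.* b) (sym (ℤ.pos-* 2 k)))
      D*∣b∣²<k² : D * (∣ b ∣ * ∣ b ∣) < k * k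
      D*∣b∣²<k² rewrite ∣b∣≡1 | ℕ.*-identityʳ D = D<k²
      bound : D * (∣ + 2 ℤ.* b ∣ * ∣ + 2 ℤ.* b ∣) < (2 * k) * (2 * k)
      bound = subst (λ y → D * (y * y) < (2 * k) * (2 * k)) (sym (ℤ.abs-* (+ 2) b))
                (double-normBound D ∣ b ∣ k D*∣b∣²<k²)

  TotPos-1mod4 : D % 4 ≡ 1 → ∀ a b x → + 2 ℤ.* a ℤ.+ b ≡ + x → ∣ b ∣ ≡ 1 → D < x * x →
                 TotPos D (a , b)
  TotPos-1mod4 D≡1 a b x 2a+b≡x ∣b∣≡1 D<x² =
    TotPos-intro {a , b} x b (trans (halfSurd-1mod4 D≡1 a b) (cong (_, b) 2a+b≡x))
      (<square⇒0< x D<x²) D*∣b∣²<x²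
    where
      D*∣b∣²<x² : D * (∣ b ∣ * ∣ b ∣) < x * x
      D*∣b∣²<x² rewrite ∣b∣≡1 | ℕ.*-identityʳ D = D<x²

  trace-sumK : ∀ {l} → All (TotPos D) l → trace D (sumK l) ≡ + sum (map (traceℕ D) l)
  trace-sumK [] = trace-rational 0ℤ
  trace-sumK {γ ∷ l} (γ⁺ ∷ l⁺) = begin
    trace D (γ +K sumK l)                    ≡⟨ trace-+K γ (sumK l) ⟩
    trace D γ ℤ.+ trace D (sumK l)           ≡⟨ cong₂ ℤ._+_ (TotPos⇒trace≡+traceℕ γ⁺) (trace-sumK l⁺) ⟩
    + (traceℕ D γ + sum (map (traceℕ D) l))  ∎
    where open ≡-Reasoning

  partition-traceSum : ∀ {n l} → IsPartitionK D (ιK n) l → sum (map (traceℕ D) l) ≡ 2 * n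
  partition-traceSum {n} (_ , l⁺ , Σl≡n) = ℤ.+-injective
    (trans (sym (trace-sumK l⁺)) (trans (cong (trace D) Σl≡n) (cong proj₁ (halfSurd-ιK n))))

  -- Traces of totally positive irrational elements

  traceBound : ∀ {m γ} → m * m < D → TotPos D γ → ¬ Rational γ → m < traceℕ D γ
  traceBound m²<D γ⁺ γ-irr =
    normBound⇒< m²<D (irrational⇒0<∣surdCoeff∣ γ-irr) (TotPos⇒normBound γ⁺)

  traceBound-2,3mod4 : D % 4 ≡ 2 ⊎ D % 4 ≡ 3 → ∀ {n γ} → E n < D →
                       TotPos D γ → ¬ Rational γ → n < traceℕ D γ
  traceBound-2,3mod4 D≢1 {n} {a , b} E<D γ⁺ b≢0 =
    subst (n <_) (sym trace≡2∣a∣) (/2<⇒<2* n/2<∣a∣)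
    where
      halfSurd≡ = halfSurd-2,3mod4 D≢1 a b
      trace≡2∣a∣ : traceℕ D (a , b) ≡ 2 * ∣ a ∣
      trace≡2∣a∣ = trans (cong (λ h → ∣ proj₁ h ∣) halfSurd≡) (ℤ.abs-* (+ 2) a)
      surdCoeff≡2∣b∣ : ∣ surdCoeff D (a , b) ∣ ≡ 2 * ∣ b ∣
      surdCoeff≡2∣b∣ = trans (cong (λ h → ∣ proj₂ h ∣) halfSurd≡) (ℤ.abs-* (+ 2) b)
      n/2<∣a∣ : n / 2 < ∣ a ∣
      n/2<∣a∣ = normBound⇒< E<D (i≢0⇒0<∣i∣ b≢0) (halve-normBound D ∣ b ∣ ∣ a ∣
        (subst₂ (λ y x → D * (y * y) < x * x) surdCoeff≡2∣b∣ trace≡2∣a∣ (TotPos⇒normBound γ⁺)))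

  trace≢even-1mod4 : D % 4 ≡ 1 → ∀ s {γ} → (1 + s * 2) * (1 + s * 2) < D →
                     TotPos D γ → ¬ Rational γ → traceℕ D γ ≢ suc s * 2
  trace≢even-1mod4 D≡1 s {a , b} F<D γ⁺ b≢0 trace≡n =
    contradiction (normBound⇒< {x = suc s} [1+s]²<D 0<u (halve-normBound D u (suc s) bound))
                  (ℕ.<-irrefl refl)
    where
      halfSurd≡ = halfSurd-1mod4 D≡1 a b
      u = ∣ + suc s ℤ.- a ∣
      ∣b∣≡2u : ∣ b ∣ ≡ 2 * u
      ∣b∣≡2u = ∣b∣≡2∣t-a∣ a b (suc s) (trans (sym (cong proj₁ halfSurd≡))
                 (trans (TotPos⇒trace≡+traceℕ γ⁺) (cong +_ trace≡n)))
      0<u : 0 < u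
      0<u = ℕ.*-cancelˡ-< 2 0 u (subst (0 <_) ∣b∣≡2u (i≢0⇒0<∣i∣ b≢0))
      bound : D * ((2 * u) * (2 * u)) < (2 * suc s) * (2 * suc s)
      bound = subst₂ (λ y x → D * (y * y) < x * x)
                (trans (cong (λ h → ∣ proj₂ h ∣) halfSurd≡) ∣b∣≡2u) (trans trace≡n (ℕ.*-comm (suc s) 2))
                (TotPos⇒normBound γ⁺)
      1+s≤1+2s : suc s ≤ 1 + s * 2
      1+s≤1+2s = s≤s (ℕ.m≤m*n s 2)
      [1+s]²<D : suc s * suc s < D
      [1+s]²<D = ℕ.≤-<-trans (ℕ.*-mono-≤ 1+s≤1+2s 1+s≤1+2s) F<D

  traceBound-1mod4 : D % 4 ≡ 1 → ∀ {n γ} → F n < D → TotPos D γ → ¬ Rational γ → n < traceℕ D γ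
  traceBound-1mod4 D≡1 {n} {γ} F<D γ⁺ γ-irr with parity n
  ... | odd t = traceBound {γ = γ} (subst (_< D) (F-odd t) F<D) γ⁺ γ-irr
  ... | even zero = TotPos⇒0<traceℕ γ⁺
  ... | even (suc s) = evenCase (subst (_< D) (F-even (suc s)) F<D)
    where
      evenCase : (1 + s * 2) * (1 + s * 2) < D → suc s * 2 < traceℕ D γ
      evenCase [n-1]²<D with ℕ.m≤n⇒m<n∨m≡n (traceBound {γ = γ} [n-1]²<D γ⁺ γ-irr)
      ... | inj₁ n<trace = n<trace
      ... | inj₂ n≡trace = contradiction (sym n≡trace) (trace≢even-1mod4 D≡1 s [n-1]²<D γ⁺ γ-irr)

  -- Comparing partitions in O_K with partitions in ℕ

  partitions-rational : ∀ {n} → (∀ {γ} → TotPos D γ → ¬ Rational γ → n < traceℕ D γ) →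
                        ∀ {l} → IsPartitionK D (ιK n) l → All Rational l
  partitions-rational {n} large l-part@(_ , l⁺ , Σl≡n) =
    all-rational (traceℕ D) large l⁺ (cong proj₂ Σl≡n)
      (ℕ.≤-reflexive (trans (partition-traceSum l-part) (cong (_+_ n) (ℕ.+-identityʳ n))))

  ιK-partition : ∀ {n} l → IsPartitionℕ n l → IsPartitionK D (ιK n) (map ιK l)
  ιK-partition l (l≢[] , 0<l , refl) =
    map≢[] l≢[] , All-map⁺ (All.map TotPos-ιK 0<l) , sumK-map-ιK l
    where
      map≢[] : ∀ {ks} → ¬ (ks ≡ []) → ¬ (map ιK ks ≡ [])
      map≢[] {[]} ks≢[] = contradiction refl ks≢[]
      map≢[] {_ ∷ _} _ ()

  rational-partition : ∀ {n} l → IsPartitionK D (ιK n) l → All Rational l →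
                       ∃ λ l₀ → IsPartitionℕ n l₀ × l ≡ map ιK l₀
  rational-partition {n} l (l≢[] , l⁺ , Σl≡n) l-rational =
    map rationalPart l , (l₀≢[] , All-map⁺ (All.map proj₂ ιK-and-pos) , Σl₀≡n) , l≡ιK[l₀]
    where
      ιK-and-pos : All (λ γ → ιK (rationalPart γ) ≡ γ × 0 < rationalPart γ) l
      ιK-and-pos = All.zipWith (λ (γ⁺ , γ-rational) → TotPos-rational⇒ιK γ⁺ γ-rational)
                               (l⁺ , l-rational)
      l≡ιK[l₀] : l ≡ map ιK (map rationalPart l)
      l≡ιK[l₀] = trans (sym (map-id-local (All.map proj₁ ιK-and-pos))) (map-∘ l)
      l₀≢[] : ¬ (map rationalPart l ≡ [])
      l₀≢[] l₀≡[] = l≢[] (trans l≡ιK[l₀] (cong (map ιK) l₀≡[]))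
      Σl₀≡n : sum (map rationalPart l) ≡ n
      Σl₀≡n = cong rationalPart
        (trans (sym (sumK-map-ιK (map rationalPart l))) (trans (cong sumK (sym l≡ιK[l₀])) Σl≡n))

  pKEqP-if-rational : ∀ {n} → (∀ {l} → IsPartitionK D (ιK n) l → All Rational l) → pKEqP D n
  pKEqP-if-rational {n} partitions-rational with p-exists n
  ... | m , p≡m =
    m , numUpToPerm-map ιK rationalPart (λ _ → refl) ιK-partition
          (λ l l-part → rational-partition l l-part (partitions-rational l-part)) p≡m , p≡m

  pK-exists : 0 < D → ∀ n → ∃ λ m → pK≡ D n m
  pK-exists 0<D n =
    numUpToPerm-finite _≟K_ (isPartitionK? D (ιK n)) (listsOfLength≤ (2 * n) box) partition∈
    where
      R = 2 * n + 2 * n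
      box = cartesianProduct (integersUpTo R) (integersUpTo R)
      partition∈ : ∀ l → IsPartitionK D (ιK n) l → l ∈ listsOfLength≤ (2 * n) box
      partition∈ l l-part@(_ , l⁺ , _) = ∈-listsOfLength≤ length≤2n (All.tabulate γ∈box)
        where
          Σtraces≡2n = partition-traceSum l-part
          length≤2n : length l ≤ 2 * n
          length≤2n = subst₂ _≤_ (length-map (traceℕ D) l) Σtraces≡2n
                        (length≤sum (All-map⁺ (All.map TotPos⇒0<traceℕ l⁺)))
          γ∈box : ∀ {γ} → γ ∈ l → γ ∈ box
          γ∈box {a , b} γ∈l = ∈-cartesianProduct⁺ (∈-integersUpTo (ℕ.≤-trans ∣a∣≤ R-bound))
                                                  (∈-integersUpTo (ℕ.≤-trans ∣b∣≤ R-bound))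
            where
              ∣a∣≤ = proj₁ (coords≤trace+surdCoeff a b)
              ∣b∣≤ = proj₂ (coords≤trace+surdCoeff a b)
              trace≤2n : traceℕ D (a , b) ≤ 2 * n
              trace≤2n = subst (_ ≤_) Σtraces≡2n (∈⇒≤sum (∈-map⁺ (traceℕ D) γ∈l))
              R-bound : traceℕ D (a , b) + ∣ surdCoeff D (a , b) ∣ ≤ R
              R-bound = ℕ.+-mono-≤ trace≤2n
                (ℕ.≤-trans (TotPos⇒surdCoeff≤trace 0<D {a , b} (All.lookup l⁺ γ∈l)) trace≤2n)

  pKGtP-if-irrational-partition : 0 < D → ∀ {n l γ} → IsPartitionK D (ιK n) l → γ ∈ l →
                                  ¬ Rational γ → pKGtP D n
  pKGtP-if-irrational-partition 0<D {n} {l} {γ} l-part γ∈l γ-irr with p-exists n | pK-exists 0<D n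
  ... | b , p≡b | a , pK≡a =
    a , b , pK≡a , p≡b ,
    <-numUpToPerm-map ιK rationalPart (λ _ → refl) ιK-partition p≡b pK≡a l l-part γ γ∈l
      (λ _ γ≡ιK → γ-irr (cong proj₂ γ≡ιK))

  extraPartition-2,3mod4 : D % 4 ≡ 2 ⊎ D % 4 ≡ 3 → ∀ {n} k r → k + r ≡ n → D < k * k → D < r * r →
                           IsPartitionK D (ιK n) ((+ k , + 1) ∷ (+ r , -[1+ 0 ]) ∷ [])
  extraPartition-2,3mod4 D≢1 k r k+r≡n D<k² D<r² =
    (λ ()) , TotPos-2,3mod4 D≢1 k (+ 1) refl D<k² ∷ TotPos-2,3mod4 D≢1 r -[1+ 0 ] refl D<r² ∷ [] ,
    cong (λ m → + m , 0ℤ) (trans (cong (_+_ k) (ℕ.+-identityʳ r)) k+r≡n)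

  -- n = (p + ω) + (q + 1 - ω), where the traces are 2p + 1 and 2q + 1
  extraPartition-1mod4 : D % 4 ≡ 1 → ∀ {n} p q → p + suc q ≡ n →
                         D < (1 + p * 2) * (1 + p * 2) → D < (1 + q * 2) * (1 + q * 2) →
                         IsPartitionK D (ιK n) ((+ p , + 1) ∷ (+ suc q , -[1+ 0 ]) ∷ [])
  extraPartition-1mod4 D≡1 p q p+1+q≡n D<x² D<y² =
    (λ ()) ,
    TotPos-1mod4 D≡1 (+ p) (+ 1) _ trace-α refl D<x² ∷
    TotPos-1mod4 D≡1 (+ suc q) -[1+ 0 ] _ trace-β refl D<y² ∷ [] ,
    cong (λ m → + m , 0ℤ) (trans (cong (_+_ p) (ℕ.+-identityʳ (suc q))) p+1+q≡n)
    where
      2p+1≡1+p*2 : ∀ p → 2 * p + 1 ≡ 1 + p * 2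
      2p+1≡1+p*2 = solve-∀
      q+[1+q]≡1+q*2 : ∀ q → q + (suc q + 0) ≡ 1 + q * 2
      q+[1+q]≡1+q*2 = solve-∀
      trace-α : + 2 ℤ.* + p ℤ.+ + 1 ≡ + (1 + p * 2)
      trace-α = trans (cong (ℤ._+ + 1) (sym (ℤ.pos-* 2 p))) (cong +_ (2p+1≡1+p*2 p))
      trace-β : + 2 ℤ.* + suc q ℤ.+ -[1+ 0 ] ≡ + (1 + q * 2)
      trace-β = trans (cong (ℤ._+ -[1+ 0 ]) (sym (ℤ.pos-* 2 (suc q)))) (cong +_ (q+[1+q]≡1+q*2 q))

  pKEqP-2,3mod4 : D % 4 ≡ 2 ⊎ D % 4 ≡ 3 → ∀ {n} → E n < D → pKEqP D n
  pKEqP-2,3mod4 D≢1 E<D = pKEqP-if-rational (partitions-rational (traceBound-2,3mod4 D≢1 E<D))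

  pKEqP-1mod4 : D % 4 ≡ 1 → ∀ {n} → F n < D → pKEqP D n
  pKEqP-1mod4 D≡1 F<D = pKEqP-if-rational (partitions-rational (traceBound-1mod4 D≡1 F<D))

  pKGtP-2,3mod4 : Admissible D → D % 4 ≡ 2 ⊎ D % 4 ≡ 3 → ∀ {n} → D ≤ E n → pKGtP D n
  pKGtP-2,3mod4 D-adm D≢1 {n} D≤E =
    pKGtP-if-irrational-partition (Admissible⇒0<D D-adm)
      (extraPartition-2,3mod4 D≢1 k r k+r≡n D<k² D<r²) (here refl) λ ()
    where
      k = n / 2
      r = n ∸ k
      D<k² : D < k * k
      D<k² = Admissible⇒<square D-adm k D≤E
      k+k≤n : k + k ≤ n
      k+k≤n = subst (_≤ n) (trans (ℕ.*-comm k 2) (cong (_+_ k) (ℕ.+-identityʳ k))) (m/n*n≤m n 2)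
      k≤r : k ≤ r
      k≤r = ℕ.m+n≤o⇒m≤o∸n k k+k≤n
      D<r² : D < r * r
      D<r² = ℕ.<-≤-trans D<k² (ℕ.*-mono-≤ k≤r k≤r)
      k+r≡n : k + r ≡ n
      k+r≡n = ℕ.m+[n∸m]≡n (m/n≤m n 2)

  pKGtP-1mod4 : Admissible D → D % 4 ≡ 1 → ∀ {n} → D ≤ F n → pKGtP D n
  pKGtP-1mod4 D-adm D≡1 {n} D≤F with parity n
  ... | odd t = pKGtP-if-irrational-partition (Admissible⇒0<D D-adm)
                  (extraPartition-1mod4 D≡1 t t (t+[1+t]≡1+t*2 t) D<n² D<n²) (here refl) λ ()
    where
      t+[1+t]≡1+t*2 : ∀ t → t + suc t ≡ 1 + t * 2
      t+[1+t]≡1+t*2 = solve-∀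
      D<n² : D < (1 + t * 2) * (1 + t * 2)
      D<n² = Admissible⇒<square D-adm (1 + t * 2) (subst (D ≤_) (F-odd t) D≤F)
  ... | even zero = contradiction (ℕ.≤-trans (proj₁ D-adm) D≤F) λ ()
  ... | even (suc s) = pKGtP-if-irrational-partition (Admissible⇒0<D D-adm)
                         (extraPartition-1mod4 D≡1 s (suc s) (s+[2+s]≡[1+s]*2 s) D<[n-1]² D<[n+1]²)
                         (here refl) λ ()
    where
      s+[2+s]≡[1+s]*2 : ∀ s → s + suc (suc s) ≡ suc s * 2
      s+[2+s]≡[1+s]*2 = solve-∀
      D<[n-1]² : D < (1 + s * 2) * (1 + s * 2)
      D<[n-1]² = Admissible⇒<square D-adm (1 + s * 2) (subst (D ≤_) (F-even (suc s)) D≤F)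
      n-1≤n+1 : 1 + s * 2 ≤ 1 + suc s * 2
      n-1≤n+1 = ℕ.+-monoʳ-≤ 1 (ℕ.*-monoˡ-≤ 2 (ℕ.n≤1+n s))
      D<[n+1]² : D < (1 + suc s * 2) * (1 + suc s * 2)
      D<[n+1]² = ℕ.<-≤-trans D<[n-1]² (ℕ.*-mono-≤ n-1≤n+1 n-1≤n+1)

theorem5p1 : (n : ℕ) → 1 ≤ n →
      (Σ ℕ λ Dn → 0 < Dn × (∀ D → Admissible D → Dn < D → pKEqP D n))
    × (∀ D → Admissible D → (D % 4 ≡ 2 ⊎ D % 4 ≡ 3) → E n < D → pKEqP D n)
    × (∀ D → Admissible D → D % 4 ≡ 1 → F n < D → pKEqP D n)
    × (∀ D → Admissible D → (D % 4 ≡ 2 ⊎ D % 4 ≡ 3) → D ≤ E n → pKGtP D n)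
    × (∀ D → Admissible D → D % 4 ≡ 1 → D ≤ F n → pKGtP D n)
theorem5p1 n 1≤n =
    (n * n , ℕ.*-mono-≤ 1≤n 1≤n , pKEqP-beyond-n²)
  , (λ D _ D≢1 E<D → pKEqP-2,3mod4 {D} D≢1 E<D)
  , (λ D _ D≡1 F<D → pKEqP-1mod4 {D} D≡1 F<D)
  , (λ D D-adm D≢1 D≤E → pKGtP-2,3mod4 D-adm D≢1 D≤E)
  , (λ D D-adm D≡1 D≤F → pKGtP-1mod4 D-adm D≡1 D≤F)
  where
    pKEqP-beyond-n² : ∀ D → Admissible D → n * n < D → pKEqP D n
    pKEqP-beyond-n² D D-adm n²<D with Admissible⇒mod4 D-adm
    ... | inj₁ D≡1 = pKEqP-1mod4 {D} D≡1 (ℕ.≤-<-trans (F≤square n) n²<D)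
    ... | inj₂ D≢1 = pKEqP-2,3mod4 {D} D≢1 (ℕ.≤-<-trans (E≤square n) n²<D)
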